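{- (i) For every even integer $w\ge0$, $W^{\mathrm{od}}_w\subseteq\mathrm{LSh}^{(2)}_w$. (ii) For every odd integer $w\ge1$, the $\mathbb Q$-linear map $\mathrm{FSh}^{\mathrm{pol}}_w\to\mathrm{LSh}^{(2)}_w$, $Q\mapsto Q\,|\,\gamma'(1-\varepsilon')\delta$, is well defined and bijective, with inverse $\mathrm{LSh}^{(2)}_w\to\mathrm{FSh}^{\mathrm{pol}}_w$, $P\mapsto-\frac13\,P\,|\,\gamma(1+\varepsilon)\delta$.
   Context: $V_w$ is the $\mathbb Q$-space of homogeneous polynomials of degree $w$ in $X,Y$. $\mathrm{GL}_2(\mathbb Z)$ acts on the right by $(P|A)(X,Y)=P(aX+bY,cX+dY)$ for $A=\begin{pmatrix}a&b\\c&d\end{pmatrix}$, extended linearly to the group ring $\mathbb Q[\mathrm{GL}_2(\mathbb Z)]$. Let $\varepsilon=\begin{pmatrix}0&1\\1&0\end{pmatrix}$, $\gamma=\begin{pmatrix}0&-1\\1&-1\end{pmatrix}$, $\delta=\begin{pmatrix}1&0\\0&-1\end{pmatrix}$, $\varepsilon'=\delta\varepsilon\delta=\begin{pmatrix}0&-1\\-1&0\end{pmatrix}$, $\gamma'=\delta\gamma\delta=\begin{pmatrix}0&1\\-1&-1\end{pmatrix}$. $\mathrm{LSh}^{(2)}_w=\{P\in V_w: P(X,X+Y)+P(Y,X+Y)=-P(X,-Y),\ P(X,Y)=P(-Y,-X)\}$. $W^{\mathrm{od}}_w=\{P\in V_w: P(X,Y)-P(X+Y,Y)-P(X+Y,X)=0\}$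 (odd period polynomials). $\mathrm{FSh}^{\mathrm{pol}}_w=\{Q\in V_w: Q(X,Y)+Q(Y,X)=0,\ Q(X,Y)+Q(X+Y,-Y)+Q(-X-Y,X)=0\}$ (polynomial part of the Fay-shuffle space). -}

module Defs where

open import Data.Nat using (ℕ; zero; suc; _∸_) renaming (_*_ to _*ℕ_)
open import Data.Fin using (Fin; toℕ) renaming (zero to fzero; suc to fsuc)
open import Data.Integer using (ℤ; +_; -[1+_])
import Data.Integer as ℤ
open import Data.Rational using (ℚ; 0ℚ; 1ℚ; _+_; _*_; -_; _/_)
open import Data.List using (List; []; _∷_; _++_; concatMap; map)
open import Data.Product using (_×_; _,_; ∃)
open import Relation.Binary.PropositionalEquality using (_≡_)

sumTo : ℕ → (ℕ → ℚ) → ℚ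
sumTo zero    f = 0ℚ
sumTo (suc n) f = f n + sumTo n f

sumFin : ∀ {n} → (Fin n → ℚ) → ℚ
sumFin {zero}  f = 0ℚ
sumFin {suc n} f = f fzero + sumFin (λ i → f (fsuc i))

-- V_w : homogeneous polynomials of degree w in X,Y over ℚ.
-- P : V w  represents  Σ_{i=0}^{w} P i · X^i Y^(w-i).

V : ℕ → Set
V w = Fin (suc w) → ℚ

_≈_ : ∀ {w} → V w → V w → Set
P ≈ Q = ∀ k → P k ≡ Q k

zeroV : ∀ {w} → V w
zeroV _ = 0ℚ

_⊞_ : ∀ {w} → V w → V w → V w
(P ⊞ Q) k = P k + Q k

_⊡_ : ∀ {w} → ℚ → V w → V w
(q ⊡ P) k = q * P k

-- Auxiliary homogeneous polynomials of implicit degree, given by the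
-- coefficient of X^k (the Y-exponent being degree − k).
Coeff : Set
Coeff = ℕ → ℚ

linF : ℚ → ℚ → Coeff
linF a b zero          = b
linF a b (suc zero)    = a
linF a b (suc (suc _)) = 0ℚ

oneC : Coeff
oneC zero    = 1ℚ
oneC (suc _) = 0ℚ

mulC : Coeff → Coeff → Coeff
mulC p q k = sumTo (suc k) (λ j → p j * q (k ∸ j))

powC : Coeff → ℕ → Coeff
powC p zero    = oneC
powC p (suc n) = mulC p (powC p n)

record Mat : Set where
  constructor mat
  field a b c d : ℤ

_⊗_ : Mat → Mat → Mat
mat a b c d ⊗ mat a' b' c' d' =
  mat (a ℤ.* a' ℤ.+ b ℤ.* c') (a ℤ.* b' ℤ.+ b ℤ.* d')
      (c ℤ.* a' ℤ.+ d ℤ.* c') (c ℤ.* b' ℤ.+ d ℤ.* d')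

toℚ : ℤ → ℚ
toℚ z = z / 1

-- (P | A)(X,Y) = P(aX+bY, cX+dY)
_∣_ : ∀ {w} → V w → Mat → V w
_∣_ {w} P (mat a b c d) k =
  sumFin (λ i → P i * mulC (powC (linF (toℚ a) (toℚ b)) (toℕ i))
                           (powC (linF (toℚ c) (toℚ d)) (w ∸ toℕ i)) (toℕ k))

-- The group ring ℚ[GL₂(ℤ)] as formal finite combinations Σ qᵢ [gᵢ]

QG : Set
QG = List (ℚ × Mat)

[_] : Mat → QG
[ g ] = (1ℚ , g) ∷ []

_⊕_ : QG → QG → QG
x ⊕ y = x ++ y

_·_ : ℚ → QG → QG
q · x = map (λ { (r , g) → (q * r , g) }) x

_⊛_ : QG → QG → QG
x ⊛ y = concatMap (λ { (q , g) → map (λ { (r , h) → (q * r , g ⊗ h) }) y }) x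

_∣ᴳ_ : ∀ {w} → V w → QG → V w
P ∣ᴳ []            = zeroV
P ∣ᴳ ((q , g) ∷ x) = (q ⊡ (P ∣ g)) ⊞ (P ∣ᴳ x)

I₂ ε γ δ ε′ γ′ : Mat
I₂ = mat (+ 1) (+ 0) (+ 0) (+ 1)
ε  = mat (+ 0) (+ 1) (+ 1) (+ 0)
γ  = mat (+ 0) -[1+ 0 ] (+ 1) -[1+ 0 ]
δ  = mat (+ 1) (+ 0) (+ 0) -[1+ 0 ]
ε′ = δ ⊗ (ε ⊗ δ)
γ′ = δ ⊗ (γ ⊗ δ)

-- substitutions used in the defining equations
-- P(X, X+Y)
σ₁ : Mat
σ₁ = mat (+ 1) (+ 0) (+ 1) (+ 1)
-- P(Y, X+Y)
σ₂ : Mat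
σ₂ = mat (+ 0) (+ 1) (+ 1) (+ 1)
-- P(X+Y, Y)
τ₁ : Mat
τ₁ = mat (+ 1) (+ 1) (+ 0) (+ 1)
-- P(X+Y, X)
τ₂ : Mat
τ₂ = mat (+ 1) (+ 1) (+ 1) (+ 0)
-- Q(X+Y, -Y)
ρ₁ : Mat
ρ₁ = mat (+ 1) (+ 1) (+ 0) -[1+ 0 ]
-- Q(-X-Y, X)
ρ₂ : Mat
ρ₂ = mat -[1+ 0 ] -[1+ 0 ] (+ 1) (+ 0)

-- LSh^(2)_w : P(X,X+Y) + P(Y,X+Y) = -P(X,-Y),  P(X,Y) = P(-Y,-X)
LSh2 : (w : ℕ) → V w → Set
LSh2 w P = (((P ∣ σ₁) ⊞ (P ∣ σ₂)) ≈ ((- 1ℚ) ⊡ (P ∣ δ))) × (P ≈ (P ∣ ε′))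

-- W^od_w : P(X,Y) - P(X+Y,Y) - P(X+Y,X) = 0
Wod : (w : ℕ) → V w → Set
Wod w P = ((P ⊞ ((- 1ℚ) ⊡ (P ∣ τ₁))) ⊞ ((- 1ℚ) ⊡ (P ∣ τ₂))) ≈ zeroV

-- FSh^pol_w : Q(X,Y) + Q(Y,X) = 0,  Q(X,Y) + Q(X+Y,-Y) + Q(-X-Y,X) = 0
FShpol : (w : ℕ) → V w → Set
FShpol w Q = ((Q ⊞ (Q ∣ ε)) ≈ zeroV) × (((Q ⊞ (Q ∣ ρ₁)) ⊞ (Q ∣ ρ₂)) ≈ zeroV)

Φ : ∀ {w} → V w → V w
Φ Q = Q ∣ᴳ ([ γ′ ] ⊛ (([ I₂ ] ⊕ ((- 1ℚ) · [ ε′ ])) ⊛ [ δ ]))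

Ψ : ∀ {w} → V w → V w
Ψ P = (- ((+ 1) / 3)) ⊡ (P ∣ᴳ ([ γ ] ⊛ (([ I₂ ] ⊕ [ ε ]) ⊛ [ δ ])))

Even Odd : ℕ → Set
Even w = ∃ λ n → w ≡ 2 *ℕ n
Odd w = ∃ λ n → w ≡ suc (2 *ℕ n)

-- Fix P and an index k and consider g ↦ (coefficient of X^k in P | g) on integer matrices. Since | is
-- a right action (checked by evaluating at rational points, which determine a polynomial), each defining
-- relation of W^od, LSh^(2) and FSh^pol, as well as P | (-I) = (-1)^w P, becomes an identity of this
-- function valid at every g, and every claim of the theorem is a ℚ-linear consequence of finitely many
-- such identities at explicit matrices. For (i) one more step is needed: u = P + P | δ is invariant
-- under X ↦ X + Y and Y ↦ X + Y, which forces u = 0 in positive weight, i.e. P | δ = -P.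
module Submission where

open import Algebra.Bundles using (CommutativeRing)
open import Data.Fin using (Fin; toℕ) renaming (zero to fzero; suc to fsuc)
open import Data.Fin.Properties using (toℕ≤pred[n])
open import Data.Integer as ℤ using (0ℤ; 1ℤ; -1ℤ)
import Data.Integer.Tactic.RingSolver as ℤ-Solver
open import Data.List using ([]; _∷_; map)
open import Data.Maybe.Base using (Maybe; just; nothing)
open import Data.Nat as ℕ using (ℕ; zero; suc; _∸_; z≤n; s≤s)
import Data.Nat.Properties as ℕ
open import Data.Product using (Σ; _×_; _,_; map₂)
open import Data.Rational using (ℚ; 0ℚ; 1ℚ; _+_; _*_; -_; _-_; _/_; _<_; _≤_; 1/_; >-nonZero; toℚᵘ; _≟_)
open import Data.Rational.Properties
  using ( +-*-commutativeRing; +-*-ring; +-0-group; *-zeroˡ; *-zeroʳ; +-identityˡ; +-identityʳ; *-identityˡ; *-identityʳ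
        ; +-assoc; +-comm; +-inverseʳ; *-assoc; *-distribˡ-+; *-distribʳ-+; *-inverseˡ; neg-distribˡ-*
        ; ≤-refl; <⇒≤; positive⁻¹; +-mono-≤; +-mono-<-≤
        ; toℚᵘ-fromℚᵘ; toℚᵘ-injective; toℚᵘ-homo-+; toℚᵘ-homo-* )
import Data.Rational.Unnormalised as ℚᵘ
import Data.Rational.Unnormalised.Properties as ℚᵘ
open import Algebra.Properties.CommutativeSemiring.Exp (CommutativeRing.commutativeSemiring +-*-commutativeRing)
  using (_^_; ^-distrib-*)
open import Algebra.Properties.Group +-0-group using (identityʳ-unique; inverseʳ-unique)
open import Algebra.Properties.Ring +-*-ring using (-1*x≈-x)
open import Level using (0ℓ)
open import Relation.Binary.PropositionalEquality hiding ([_])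
open import Relation.Nullary using (yes; no)
open import Tactic.RingSolver using (solve-∀; solve)
open import Tactic.RingSolver.Core.AlmostCommutativeRing using (AlmostCommutativeRing; fromCommutativeRing)

open import Defs

ℚ-ring : AlmostCommutativeRing 0ℓ 0ℓ
ℚ-ring = fromCommutativeRing +-*-commutativeRing is-zero
  where
  is-zero : (x : ℚ) → Maybe (0ℚ ≡ x)
  is-zero x with 0ℚ ≟ x
  ... | yes p = just p
  ... | no _  = nothing

sumFin-cong : ∀ {n} {f g : Fin n → ℚ} → (∀ i → f i ≡ g i) → sumFin f ≡ sumFin g
sumFin-cong {zero}  f≗g = refl
sumFin-cong {suc n} f≗g = cong₂ _+_ (f≗g fzero) (sumFin-cong (λ i → f≗g (fsuc i)))

sumFin-+ : ∀ {n} (f g : Fin n → ℚ) → sumFin (λ i → f i + g i) ≡ sumFin f + sumFin g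
sumFin-+ {zero}  f g = sym (+-identityʳ 0ℚ)
sumFin-+ {suc n} f g = trans (cong (f fzero + g fzero +_) (sumFin-+ (λ i → f (fsuc i)) (λ i → g (fsuc i))))
                             (interchange (f fzero) (g fzero) _ _)
  where
  interchange : ∀ a b c d → (a + b) + (c + d) ≡ (a + c) + (b + d)
  interchange = solve-∀ ℚ-ring

*-distribˡ-sumFin : ∀ {n} c (f : Fin n → ℚ) → c * sumFin f ≡ sumFin (λ i → c * f i)
*-distribˡ-sumFin {zero}  c f = *-zeroʳ c
*-distribˡ-sumFin {suc n} c f =
  trans (*-distribˡ-+ c (f fzero) _) (cong (c * f fzero +_) (*-distribˡ-sumFin c (λ i → f (fsuc i))))

sumFin-zero : ∀ {n} {f : Fin n → ℚ} → (∀ i → f i ≡ 0ℚ) → sumFin f ≡ 0ℚ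
sumFin-zero {zero}  f≗0 = refl
sumFin-zero {suc n} f≗0 = trans (cong₂ _+_ (f≗0 fzero) (sumFin-zero (λ i → f≗0 (fsuc i)))) (+-identityʳ 0ℚ)

sumTo-zero : ∀ n (f : ℕ → ℚ) → (∀ j → j ℕ.< n → f j ≡ 0ℚ) → sumTo n f ≡ 0ℚ
sumTo-zero zero    f f≗0 = refl
sumTo-zero (suc n) f f≗0 =
  cong₂ _+_ (f≗0 n ℕ.≤-refl) (sumTo-zero n f (λ j j<n → f≗0 j (ℕ.m≤n⇒m≤1+n j<n)))

sumTo-suc : ∀ n (f : ℕ → ℚ) → sumTo (suc n) f ≡ f 0 + sumTo n (λ j → f (suc j))
sumTo-suc zero    f = refl
sumTo-suc (suc n) f = trans (cong (f (suc n) +_) (sumTo-suc n f)) (swap (f (suc n)) (f 0) _)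
  where
  swap : ∀ a b c → a + (b + c) ≡ b + (a + c)
  swap = solve-∀ ℚ-ring

-- Evaluation at rational points

shift : Coeff → Coeff
shift F k = F (suc k)

evalᶜ : ℕ → Coeff → ℚ → ℚ → ℚ
evalᶜ zero    F x y = F 0
evalᶜ (suc n) F x y = F 0 * y ^ suc n + x * evalᶜ n (shift F) x y

eval : ∀ {w} → V w → ℚ → ℚ → ℚ
eval {zero}  P x y = P fzero
eval {suc w} P x y = P fzero * y ^ suc w + x * eval (λ i → P (fsuc i)) x y

eval-toℕ : ∀ w (F : Coeff) x y → eval {w} (λ k → F (toℕ k)) x y ≡ evalᶜ w F x y
eval-toℕ zero    F x y = refl
eval-toℕ (suc w) F x y = cong (λ e → F 0 * y ^ suc w + x * e) (eval-toℕ w (shift F) x y)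

evalᶜ-cong : ∀ n (F G : Coeff) x y → (∀ k → k ℕ.≤ n → F k ≡ G k) → evalᶜ n F x y ≡ evalᶜ n G x y
evalᶜ-cong zero    F G x y F≗G = F≗G 0 z≤n
evalᶜ-cong (suc n) F G x y F≗G = cong₂ (λ a e → a * y ^ suc n + x * e) (F≗G 0 z≤n)
  (evalᶜ-cong n (shift F) (shift G) x y (λ k k≤n → F≗G (suc k) (s≤s k≤n)))

horner-+ : ∀ a b p x c d → (a + b) * p + x * (c + d) ≡ (a * p + x * c) + (b * p + x * d)
horner-+ = solve-∀ ℚ-ring

horner-* : ∀ c a p x e → (c * a) * p + x * (c * e) ≡ c * (a * p + x * e)
horner-* = solve-∀ ℚ-ring

horner-0 : ∀ p x → 0ℚ * p + x * 0ℚ ≡ 0ℚ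
horner-0 = solve-∀ ℚ-ring

evalᶜ-+ : ∀ n (F G : Coeff) x y → evalᶜ n (λ k → F k + G k) x y ≡ evalᶜ n F x y + evalᶜ n G x y
evalᶜ-+ zero    F G x y = refl
evalᶜ-+ (suc n) F G x y =
  trans (cong (λ e → (F 0 + G 0) * y ^ suc n + x * e) (evalᶜ-+ n (shift F) (shift G) x y))
        (horner-+ (F 0) (G 0) _ x _ _)

evalᶜ-* : ∀ n c (F : Coeff) x y → evalᶜ n (λ k → c * F k) x y ≡ c * evalᶜ n F x y
evalᶜ-* zero    c F x y = refl
evalᶜ-* (suc n) c F x y =
  trans (cong (λ e → (c * F 0) * y ^ suc n + x * e) (evalᶜ-* n c (shift F) x y))
        (horner-* c (F 0) _ x _)

evalᶜ-zero : ∀ n x y → evalᶜ n (λ _ → 0ℚ) x y ≡ 0ℚ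
evalᶜ-zero zero    x y = refl
evalᶜ-zero (suc n) x y =
  trans (cong (λ e → 0ℚ * y ^ suc n + x * e) (evalᶜ-zero n x y)) (horner-0 (y ^ suc n) x)

evalᶜ-sum : ∀ {m} n (G : Fin m → Coeff) x y →
  evalᶜ n (λ k → sumFin (λ i → G i k)) x y ≡ sumFin (λ i → evalᶜ n (G i) x y)
evalᶜ-sum {zero}  n G x y = evalᶜ-zero n x y
evalᶜ-sum {suc m} n G x y =
  trans (evalᶜ-+ n (G fzero) (λ k → sumFin (λ i → G (fsuc i) k)) x y)
        (cong (evalᶜ n (G fzero) x y +_) (evalᶜ-sum n (λ i → G (fsuc i)) x y))

Degree≤ : ℕ → Coeff → Set
Degree≤ n F = ∀ k → n ℕ.< k → F k ≡ 0ℚ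

linF-degree≤1 : ∀ a b → Degree≤ 1 (linF a b)
linF-degree≤1 a b (suc (suc k)) _ = refl
linF-degree≤1 a b (suc zero) (s≤s ())

oneC-degree≤0 : Degree≤ 0 oneC
oneC-degree≤0 (suc k) _ = refl

mulC-degree≤ : ∀ m n F G → Degree≤ m F → Degree≤ n G → Degree≤ (m ℕ.+ n) (mulC F G)
mulC-degree≤ m n F G F≤m G≤n k m+n<k = sumTo-zero (suc k) _ vanishes
  where
  vanishes : ∀ j → j ℕ.< suc k → F j * G (k ∸ j) ≡ 0ℚ
  vanishes j _ with m ℕ.<? j
  ... | yes m<j = trans (cong (_* G (k ∸ j)) (F≤m j m<j)) (*-zeroˡ (G (k ∸ j)))
  ... | no m≮j = trans (cong (F j *_) (G≤n (k ∸ j) n<k∸j)) (*-zeroʳ (F j))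
    where
    n<k∸j : n ℕ.< k ∸ j
    n<k∸j = ℕ.m+n≤o⇒m≤o∸n (suc n) (ℕ.≤-trans (s≤s (ℕ.+-monoʳ-≤ n (ℕ.≮⇒≥ m≮j)))
                                             (subst (ℕ._≤ k) (cong suc (ℕ.+-comm m n)) m+n<k))

powC-degree≤ : ∀ a b n → Degree≤ n (powC (linF a b) n)
powC-degree≤ a b zero    = oneC-degree≤0
powC-degree≤ a b (suc n) = mulC-degree≤ 1 n _ _ (linF-degree≤1 a b) (powC-degree≤ a b n)

evalᶜ-top : ∀ n (G : Coeff) x y → evalᶜ (suc n) G x y ≡ y * evalᶜ n G x y + G (suc n) * x ^ suc n
evalᶜ-top zero    G x y = base (G 0) (G 1) y x
  where
  base : ∀ g₀ g₁ y x → g₀ * (y * 1ℚ) + x * g₁ ≡ y * g₀ + g₁ * (x * 1ℚ)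
  base = solve-∀ ℚ-ring
evalᶜ-top (suc n) G x y =
  trans (cong (λ e → G 0 * y ^ suc (suc n) + x * e) (evalᶜ-top n (shift G) x y))
        (step (G 0) (y ^ suc n) x y (evalᶜ n (shift G) x y) (G (suc (suc n))) (x ^ suc n))
  where
  step : ∀ g₀ yⁿ x y e g xⁿ → g₀ * (y * yⁿ) + x * (y * e + g * xⁿ) ≡ y * (g₀ * yⁿ + x * e) + g * (x * xⁿ)
  step = solve-∀ ℚ-ring

evalᶜ-pad : ∀ n (G : Coeff) x y → Degree≤ n G → ∀ e → evalᶜ (e ℕ.+ n) G x y ≡ y ^ e * evalᶜ n G x y
evalᶜ-pad n G x y G≤n zero    = sym (*-identityˡ _)
evalᶜ-pad n G x y G≤n (suc e) = begin
    evalᶜ (suc (e ℕ.+ n)) G x y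
  ≡⟨ evalᶜ-top (e ℕ.+ n) G x y ⟩
    y * evalᶜ (e ℕ.+ n) G x y + G (suc (e ℕ.+ n)) * x ^ suc (e ℕ.+ n)
  ≡⟨ cong₂ (λ a b → y * a + b * x ^ suc (e ℕ.+ n)) (evalᶜ-pad n G x y G≤n e) (G≤n _ (s≤s (ℕ.m≤n+m n e))) ⟩
    y * (y ^ e * evalᶜ n G x y) + 0ℚ * x ^ suc (e ℕ.+ n)
  ≡⟨ drop y (y ^ e) (evalᶜ n G x y) (x ^ suc (e ℕ.+ n)) ⟩
    y * y ^ e * evalᶜ n G x y
  ∎
  where
  open ≡-Reasoning
  drop : ∀ y yᵉ g xⁿ → y * (yᵉ * g) + 0ℚ * xⁿ ≡ y * yᵉ * g
  drop = solve-∀ ℚ-ring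

mulC-suc : ∀ (F G : Coeff) k → mulC F G (suc k) ≡ F 0 * G (suc k) + mulC (shift F) G k
mulC-suc F G k = sumTo-suc (suc k) (λ j → F j * G (suc k ∸ j))

mulC-degree0 : ∀ (F G : Coeff) → Degree≤ 0 F → ∀ k → mulC F G k ≡ F 0 * G k
mulC-degree0 F G F≤0 k = begin
    mulC F G k                                             ≡⟨ sumTo-suc k (λ j → F j * G (k ∸ j)) ⟩
    F 0 * G k + sumTo k (λ j → F (suc j) * G (k ∸ suc j))  ≡⟨ cong (F 0 * G k +_) (sumTo-zero k _ higher) ⟩
    F 0 * G k + 0ℚ                                         ≡⟨ +-identityʳ (F 0 * G k) ⟩
    F 0 * G k                                              ∎
  where
  open ≡-Reasoning
  higher : ∀ j → j ℕ.< k → F (suc j) * G (k ∸ suc j) ≡ 0ℚ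
  higher j _ = trans (cong (_* G (k ∸ suc j)) (F≤0 (suc j) (s≤s z≤n))) (*-zeroˡ (G (k ∸ suc j)))

evalᶜ-mulC : ∀ m n (F G : Coeff) x y → Degree≤ m F → Degree≤ n G →
  evalᶜ (m ℕ.+ n) (mulC F G) x y ≡ evalᶜ m F x y * evalᶜ n G x y
evalᶜ-mulC zero    n F G x y F≤0 G≤n =
  trans (evalᶜ-cong n (mulC F G) (λ k → F 0 * G k) x y (λ k _ → mulC-degree0 F G F≤0 k)) (evalᶜ-* n (F 0) G x y)
evalᶜ-mulC (suc m) n F G x y F≤m G≤n = begin
    (F 0 * G 0 + 0ℚ) * y ^ suc (m ℕ.+ n) + x * evalᶜ (m ℕ.+ n) (shift (mulC F G)) x y
  ≡⟨ cong (λ e → (F 0 * G 0 + 0ℚ) * y ^ suc (m ℕ.+ n) + x * e) tail ⟩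
    (F 0 * G 0 + 0ℚ) * y ^ suc (m ℕ.+ n) + x * (F 0 * evalᶜ (m ℕ.+ n) (shift G) x y + evalᶜ m (shift F) x y * evalᶜ n G x y)
  ≡⟨ regroup (F 0) (G 0) (y ^ suc (m ℕ.+ n)) x (evalᶜ (m ℕ.+ n) (shift G) x y) (evalᶜ m (shift F) x y) (evalᶜ n G x y) (y ^ suc m)
       (evalᶜ-pad n G x y G≤n (suc m)) ⟩
    evalᶜ (suc m) F x y * evalᶜ n G x y
  ∎
  where
  open ≡-Reasoning
  tail : evalᶜ (m ℕ.+ n) (shift (mulC F G)) x y
       ≡ F 0 * evalᶜ (m ℕ.+ n) (shift G) x y + evalᶜ m (shift F) x y * evalᶜ n G x y
  tail = trans (evalᶜ-cong (m ℕ.+ n) _ (λ k → F 0 * G (suc k) + mulC (shift F) G k) x y (λ k _ → mulC-suc F G k))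
    (trans (evalᶜ-+ (m ℕ.+ n) (λ k → F 0 * G (suc k)) (mulC (shift F) G) x y)
           (cong₂ _+_ (evalᶜ-* (m ℕ.+ n) (F 0) (shift G) x y)
                      (evalᶜ-mulC m n (shift F) G x y (λ k m<k → F≤m (suc k) (s≤s m<k)) G≤n)))
  regroup : ∀ f₀ g₀ Y x A B E Yᵐ → g₀ * Y + x * A ≡ Yᵐ * E →
            (f₀ * g₀ + 0ℚ) * Y + x * (f₀ * A + B * E) ≡ (f₀ * Yᵐ + x * B) * E
  regroup f₀ g₀ Y x A B E Yᵐ pad = trans (expand f₀ g₀ Y x A B E)
    (trans (cong (λ z → f₀ * z + x * B * E) pad) (factor f₀ Yᵐ x B E))
    where
    expand : ∀ f₀ g₀ Y x A B E → (f₀ * g₀ + 0ℚ) * Y + x * (f₀ * A + B * E) ≡ f₀ * (g₀ * Y + x * A) + x * B * E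
    expand = solve-∀ ℚ-ring
    factor : ∀ f₀ Yᵐ x B E → f₀ * (Yᵐ * E) + x * B * E ≡ (f₀ * Yᵐ + x * B) * E
    factor = solve-∀ ℚ-ring

evalᶜ-powC : ∀ a b n x y → evalᶜ n (powC (linF a b) n) x y ≡ (a * x + b * y) ^ n
evalᶜ-powC a b zero    x y = refl
evalᶜ-powC a b (suc n) x y =
  trans (evalᶜ-mulC 1 n (linF a b) (powC (linF a b) n) x y (linF-degree≤1 a b) (powC-degree≤ a b n))
        (cong₂ _*_ (linear a b x y) (evalᶜ-powC a b n x y))
  where
  linear : ∀ a b x y → b * (y * 1ℚ) + x * a ≡ a * x + b * y
  linear = solve-∀ ℚ-ring

eval-⊞ : ∀ {w} (P Q : V w) x y → eval (P ⊞ Q) x y ≡ eval P x y + eval Q x y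
eval-⊞ {zero}  P Q x y = refl
eval-⊞ {suc w} P Q x y =
  trans (cong (λ e → (P fzero + Q fzero) * y ^ suc w + x * e) (eval-⊞ (λ i → P (fsuc i)) (λ i → Q (fsuc i)) x y))
        (horner-+ (P fzero) (Q fzero) _ x _ _)

eval-⊡ : ∀ {w} c (P : V w) x y → eval (c ⊡ P) x y ≡ c * eval P x y
eval-⊡ {zero}  c P x y = refl
eval-⊡ {suc w} c P x y =
  trans (cong (λ e → (c * P fzero) * y ^ suc w + x * e) (eval-⊡ c (λ i → P (fsuc i)) x y))
        (horner-* c (P fzero) _ x _)

eval-cong : ∀ {w} {P Q : V w} x y → P ≈ Q → eval P x y ≡ eval Q x y
eval-cong {zero}  x y P≈Q = P≈Q fzero
eval-cong {suc w} x y P≈Q =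
  cong₂ (λ a e → a * y ^ suc w + x * e) (P≈Q fzero) (eval-cong x y (λ i → P≈Q (fsuc i)))

eval-zero : ∀ {w} {P : V w} x y → P ≈ zeroV → eval P x y ≡ 0ℚ
eval-zero {zero}  x y P≈0 = P≈0 fzero
eval-zero {suc w} x y P≈0 =
  trans (cong₂ (λ a e → a * y ^ suc w + x * e) (P≈0 fzero) (eval-zero x y (λ i → P≈0 (fsuc i))))
        (horner-0 (y ^ suc w) x)

eval-monomials : ∀ {w} (P : V w) x y → eval P x y ≡ sumFin (λ i → P i * (x ^ toℕ i * y ^ (w ∸ toℕ i)))
eval-monomials {zero}  P x y = constant (P fzero)
  where
  constant : ∀ a → a ≡ a * (1ℚ * 1ℚ) + 0ℚ
  constant = solve-∀ ℚ-ring
eval-monomials {suc w} P x y = begin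
    P fzero * y ^ suc w + x * eval (λ i → P (fsuc i)) x y
  ≡⟨ cong (λ e → P fzero * y ^ suc w + x * e) (eval-monomials (λ i → P (fsuc i)) x y) ⟩
    P fzero * y ^ suc w + x * sumFin (λ i → P (fsuc i) * (x ^ toℕ i * y ^ (w ∸ toℕ i)))
  ≡⟨ cong₂ _+_ (unit (P fzero) (y ^ suc w)) (*-distribˡ-sumFin x (λ i → P (fsuc i) * (x ^ toℕ i * y ^ (w ∸ toℕ i)))) ⟩
    P fzero * (1ℚ * y ^ suc w) + sumFin (λ i → x * (P (fsuc i) * (x ^ toℕ i * y ^ (w ∸ toℕ i))))
  ≡⟨ cong (P fzero * (1ℚ * y ^ suc w) +_) (sumFin-cong (λ i → rotate x (P (fsuc i)) (x ^ toℕ i) (y ^ (w ∸ toℕ i)))) ⟩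
    P fzero * (1ℚ * y ^ suc w) + sumFin (λ i → P (fsuc i) * ((x * x ^ toℕ i) * y ^ (w ∸ toℕ i)))
  ∎
  where
  open ≡-Reasoning
  unit : ∀ a b → a * b ≡ a * (1ℚ * b)
  unit = solve-∀ ℚ-ring
  rotate : ∀ x p a b → x * (p * (a * b)) ≡ p * ((x * a) * b)
  rotate = solve-∀ ℚ-ring

eval-∣ : ∀ {w} (P : V w) a b c d x y →
  eval (P ∣ mat a b c d) x y ≡ eval P (toℚ a * x + toℚ b * y) (toℚ c * x + toℚ d * y)
eval-∣ {w} P a b c d x y = begin
    eval (P ∣ mat a b c d) x y
  ≡⟨ eval-toℕ w (λ n → sumFin (λ i → P i * C i n)) x y ⟩
    evalᶜ w (λ n → sumFin (λ i → P i * C i n)) x y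
  ≡⟨ evalᶜ-sum w (λ i n → P i * C i n) x y ⟩
    sumFin (λ i → evalᶜ w (λ n → P i * C i n) x y)
  ≡⟨ sumFin-cong (λ i → trans (evalᶜ-* w (P i) (C i) x y) (cong (P i *_) (monomial i))) ⟩
    sumFin (λ i → P i * (L₁ ^ toℕ i * L₂ ^ (w ∸ toℕ i)))
  ≡⟨ eval-monomials P L₁ L₂ ⟨
    eval P L₁ L₂
  ∎
  where
  open ≡-Reasoning
  L₁ = toℚ a * x + toℚ b * y
  L₂ = toℚ c * x + toℚ d * y
  C : Fin (suc w) → Coeff
  C i = mulC (powC (linF (toℚ a) (toℚ b)) (toℕ i)) (powC (linF (toℚ c) (toℚ d)) (w ∸ toℕ i))
  monomial : ∀ i → evalᶜ w (C i) x y ≡ L₁ ^ toℕ i * L₂ ^ (w ∸ toℕ i)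
  monomial i = trans (cong (λ N → evalᶜ N (C i) x y) (sym (ℕ.m+[n∸m]≡n (toℕ≤pred[n] i))))
    (trans (evalᶜ-mulC (toℕ i) (w ∸ toℕ i) _ _ x y (powC-degree≤ _ _ (toℕ i)) (powC-degree≤ _ _ (w ∸ toℕ i)))
           (cong₂ _*_ (evalᶜ-powC _ _ (toℕ i) x y) (evalᶜ-powC _ _ (w ∸ toℕ i) x y)))

-- A polynomial is determined by its values

fromℕ : ℕ → ℚ
fromℕ zero    = 0ℚ
fromℕ (suc n) = 1ℚ + fromℕ n

fromℕ-+ : ∀ m n → fromℕ (m ℕ.+ n) ≡ fromℕ m + fromℕ n
fromℕ-+ zero    n = sym (+-identityˡ (fromℕ n))
fromℕ-+ (suc m) n = trans (cong (1ℚ +_) (fromℕ-+ m n)) (sym (+-assoc 1ℚ (fromℕ m) (fromℕ n)))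

fromℕ-nonNeg : ∀ n → 0ℚ ≤ fromℕ n
fromℕ-nonNeg zero    = ≤-refl
fromℕ-nonNeg (suc n) = +-mono-≤ (<⇒≤ (positive⁻¹ 1ℚ)) (fromℕ-nonNeg n)

fromℕ-suc-pos : ∀ n → 0ℚ < fromℕ (suc n)
fromℕ-suc-pos n = +-mono-<-≤ (positive⁻¹ 1ℚ) (fromℕ-nonNeg n)

*-cancelˡ-zero : ∀ t s → 0ℚ < t → t * s ≡ 0ℚ → s ≡ 0ℚ
*-cancelˡ-zero t s 0<t ts≡0 = begin
    s                  ≡⟨ *-identityˡ s ⟨
    1ℚ * s             ≡⟨ cong (_* s) (*-inverseˡ t) ⟨
    (1/ t) * t * s     ≡⟨ *-assoc (1/ t) t s ⟩
    (1/ t) * (t * s)   ≡⟨ cong ((1/ t) *_) ts≡0 ⟩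
    (1/ t) * 0ℚ        ≡⟨ *-zeroʳ (1/ t) ⟩
    0ℚ                 ∎
  where
  open ≡-Reasoning
  instance _ = >-nonZero 0<t

1^n≡1 : ∀ n → 1ℚ ^ n ≡ 1ℚ
1^n≡1 zero    = refl
1^n≡1 (suc n) = trans (cong (1ℚ *_) (1^n≡1 n)) (*-identityˡ 1ℚ)

two : ℚ
two = fromℕ 2

2^[1+i]-1≡fromℕ[1+K] : ∀ i → Σ ℕ (λ K → two ^ suc i + - 1ℚ ≡ fromℕ (suc K))
2^[1+i]-1≡fromℕ[1+K] zero    = 0 , refl
2^[1+i]-1≡fromℕ[1+K] (suc i) with 2^[1+i]-1≡fromℕ[1+K] i
... | K , eq = suc K ℕ.+ suc K ,
  trans (double (two ^ suc i)) (trans (cong (λ z → 1ℚ + (z + z)) eq) (cong (1ℚ +_) (sym (fromℕ-+ (suc K) (suc K)))))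
  where
  double : ∀ p → two * p + - 1ℚ ≡ 1ℚ + ((p + - 1ℚ) + (p + - 1ℚ))
  double = solve-∀ ℚ-ring

eval-scaleˣ : ∀ {w} (P : V w) c t → eval P (c * t) 1ℚ ≡ eval (λ i → P i * c ^ toℕ i) t 1ℚ
eval-scaleˣ {zero}  P c t = sym (*-identityʳ (P fzero))
eval-scaleˣ {suc w} P c t = begin
    P fzero * 1ℚ ^ suc w + (c * t) * eval (λ i → P (fsuc i)) (c * t) 1ℚ
  ≡⟨ cong (λ e → P fzero * 1ℚ ^ suc w + (c * t) * e) (eval-scaleˣ (λ i → P (fsuc i)) c t) ⟩
    P fzero * 1ℚ ^ suc w + (c * t) * eval T t 1ℚ
  ≡⟨ regroup (P fzero) (1ℚ ^ suc w) c t (eval T t 1ℚ) ⟩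
    (P fzero * 1ℚ) * 1ℚ ^ suc w + t * (c * eval T t 1ℚ)
  ≡⟨ cong (λ e → (P fzero * 1ℚ) * 1ℚ ^ suc w + t * e)
       (trans (sym (eval-⊡ c T t 1ℚ)) (eval-cong t 1ℚ (λ i → swap c (P (fsuc i)) (c ^ toℕ i)))) ⟩
    (P fzero * 1ℚ) * 1ℚ ^ suc w + t * eval (λ i → P (fsuc i) * (c * c ^ toℕ i)) t 1ℚ
  ∎
  where
  open ≡-Reasoning
  T = λ i → P (fsuc i) * c ^ toℕ i
  regroup : ∀ p₀ u c t e → p₀ * u + (c * t) * e ≡ (p₀ * 1ℚ) * u + t * (c * e)
  regroup = solve-∀ ℚ-ring
  swap : ∀ c p a → c * (p * a) ≡ p * (c * a)
  swap = solve-∀ ℚ-ring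

VanishesOnℕ⁺ : ∀ {w} → V w → Set
VanishesOnℕ⁺ P = ∀ n → eval P (fromℕ (suc n)) 1ℚ ≡ 0ℚ

-- D(t) = P(2t, 1) - P(t, 1) has constant term 0 and coefficients (2^i - 1) P_i;
-- D(t) / t vanishes on ℕ⁺ too (ℕ⁺ is closed under doubling), so induction kills all P_i with i > 0,
-- and then P(1, 1) = P_0.
vanishesOnℕ⁺⇒zero : ∀ {w} (P : V w) → VanishesOnℕ⁺ P → P ≈ zeroV
vanishesOnℕ⁺⇒zero {zero}  P P≡0 fzero = P≡0 0
vanishesOnℕ⁺⇒zero {suc w} P P≡0 = λ { fzero → head≡0 ; (fsuc i) → tail≡0 i }
  where
  open ≡-Reasoning
  D : V (suc w)
  D i = P i * two ^ toℕ i + - P i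
  eval-D : ∀ t → eval D t 1ℚ ≡ eval P (two * t) 1ℚ + - eval P t 1ℚ
  eval-D t = begin
      eval D t 1ℚ
    ≡⟨ eval-cong t 1ℚ (λ i → split (P i) (two ^ toℕ i)) ⟩
      eval ((λ i → P i * two ^ toℕ i) ⊞ ((- 1ℚ) ⊡ P)) t 1ℚ
    ≡⟨ eval-⊞ (λ i → P i * two ^ toℕ i) ((- 1ℚ) ⊡ P) t 1ℚ ⟩
      eval (λ i → P i * two ^ toℕ i) t 1ℚ + eval ((- 1ℚ) ⊡ P) t 1ℚ
    ≡⟨ cong₂ _+_ (sym (eval-scaleˣ P two t)) (eval-⊡ (- 1ℚ) P t 1ℚ) ⟩
      eval P (two * t) 1ℚ + (- 1ℚ) * eval P t 1ℚ
    ≡⟨ cong (eval P (two * t) 1ℚ +_) (-1*x≈-x (eval P t 1ℚ)) ⟩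
      eval P (two * t) 1ℚ + - eval P t 1ℚ
    ∎
    where
    split : ∀ p a → p * a + - p ≡ p * a + (- 1ℚ) * p
    split = solve-∀ ℚ-ring
  D/t-vanishes : VanishesOnℕ⁺ (λ i → D (fsuc i))
  D/t-vanishes n = *-cancelˡ-zero (fromℕ (suc n)) _ (fromℕ-suc-pos n) (begin
      fromℕ (suc n) * eval (λ i → D (fsuc i)) (fromℕ (suc n)) 1ℚ
    ≡⟨ no-constant-term (P fzero) (1ℚ ^ suc w) (fromℕ (suc n)) _ ⟨
      eval D (fromℕ (suc n)) 1ℚ
    ≡⟨ eval-D (fromℕ (suc n)) ⟩
      eval P (two * fromℕ (suc n)) 1ℚ + - eval P (fromℕ (suc n)) 1ℚ
    ≡⟨ cong₂ (λ a b → a + - b) (trans (cong (λ z → eval P z 1ℚ) (doubling n)) (P≡0 (n ℕ.+ suc n))) (P≡0 n) ⟩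
      0ℚ + - 0ℚ
    ≡⟨⟩
      0ℚ
    ∎)
    where
    no-constant-term : ∀ a u t e → (a * 1ℚ + - a) * u + t * e ≡ t * e
    no-constant-term = solve-∀ ℚ-ring
    doubling : ∀ n → two * fromℕ (suc n) ≡ fromℕ (suc n ℕ.+ suc n)
    doubling n = trans (twice (fromℕ (suc n))) (sym (fromℕ-+ (suc n) (suc n)))
      where
      twice : ∀ a → two * a ≡ a + a
      twice = solve-∀ ℚ-ring
  tail≡0 : ∀ i → P (fsuc i) ≡ 0ℚ
  tail≡0 i with 2^[1+i]-1≡fromℕ[1+K] (toℕ i)
  ... | K , eq = *-cancelˡ-zero (fromℕ (suc K)) (P (fsuc i)) (fromℕ-suc-pos K)
    (trans (cong (_* P (fsuc i)) (sym eq))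
      (trans (factor (P (fsuc i)) (two ^ suc (toℕ i))) (vanishesOnℕ⁺⇒zero (λ j → D (fsuc j)) D/t-vanishes i)))
    where
    factor : ∀ p a → (a + - 1ℚ) * p ≡ p * a + - p
    factor = solve-∀ ℚ-ring
  head≡0 : P fzero ≡ 0ℚ
  head≡0 = begin
      P fzero
    ≡⟨ at-one (P fzero) ⟨
      P fzero * 1ℚ + fromℕ 1 * 0ℚ
    ≡⟨ cong (λ u → P fzero * u + fromℕ 1 * 0ℚ) (1^n≡1 (suc w)) ⟨
      P fzero * 1ℚ ^ suc w + fromℕ 1 * 0ℚ
    ≡⟨ cong (λ e → P fzero * 1ℚ ^ suc w + fromℕ 1 * e) (eval-zero (fromℕ 1) 1ℚ tail≡0) ⟨
      eval P (fromℕ 1) 1ℚ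
    ≡⟨ P≡0 0 ⟩
      0ℚ
    ∎
    where
    at-one : ∀ p → p * 1ℚ + fromℕ 1 * 0ℚ ≡ p
    at-one = solve-∀ ℚ-ring

eval-injective : ∀ {w} (P Q : V w) → (∀ x y → eval P x y ≡ eval Q x y) → P ≈ Q
eval-injective P Q P≗Q k = begin
    P k                             ≡⟨ shuffle (P k) (Q k) ⟩
    (P k + (- 1ℚ) * Q k) + Q k      ≡⟨ cong (_+ Q k) (vanishesOnℕ⁺⇒zero (P ⊞ ((- 1ℚ) ⊡ Q)) difference k) ⟩
    0ℚ + Q k                        ≡⟨ +-identityˡ (Q k) ⟩
    Q k                             ∎
  where
  open ≡-Reasoning
  shuffle : ∀ a b → a ≡ (a + (- 1ℚ) * b) + b
  shuffle = solve-∀ ℚ-ring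
  cancel : ∀ a → a + (- 1ℚ) * a ≡ 0ℚ
  cancel = solve-∀ ℚ-ring
  difference : VanishesOnℕ⁺ (P ⊞ ((- 1ℚ) ⊡ Q))
  difference n = trans (eval-⊞ P _ _ _) (trans (cong₂ _+_ (P≗Q _ _) (eval-⊡ (- 1ℚ) Q _ _)) (cancel (eval Q (fromℕ (suc n)) 1ℚ)))

toℚᵘ-toℚ : ∀ z → toℚᵘ (toℚ z) ℚᵘ.≃ ℚᵘ.mkℚᵘ z 0
toℚᵘ-toℚ z = toℚᵘ-fromℚᵘ (ℚᵘ.mkℚᵘ z 0)

toℚ-+ : ∀ m n → toℚ (m ℤ.+ n) ≡ toℚ m + toℚ n
toℚ-+ m n = toℚᵘ-injective (ℚᵘ.≃-trans (toℚᵘ-toℚ (m ℤ.+ n))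
  (ℚᵘ.≃-trans (ℚᵘ.*≡* (integral m n))
    (ℚᵘ.≃-sym (ℚᵘ.≃-trans (toℚᵘ-homo-+ (toℚ m) (toℚ n)) (ℚᵘ.+-cong (toℚᵘ-toℚ m) (toℚᵘ-toℚ n))))))
  where
  integral : ∀ m n → (m ℤ.+ n) ℤ.* 1ℤ ≡ (m ℤ.* 1ℤ ℤ.+ n ℤ.* 1ℤ) ℤ.* 1ℤ
  integral = ℤ-Solver.solve-∀

toℚ-* : ∀ m n → toℚ (m ℤ.* n) ≡ toℚ m * toℚ n
toℚ-* m n = toℚᵘ-injective (ℚᵘ.≃-trans (toℚᵘ-toℚ (m ℤ.* n))
  (ℚᵘ.≃-trans (ℚᵘ.*≡* refl)
    (ℚᵘ.≃-sym (ℚᵘ.≃-trans (toℚᵘ-homo-* (toℚ m) (toℚ n)) (ℚᵘ.*-cong (toℚᵘ-toℚ m) (toℚᵘ-toℚ n))))))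

∣-∣ : ∀ {w} (P : V w) A B → ((P ∣ A) ∣ B) ≈ (P ∣ (A ⊗ B))
∣-∣ P A@(mat a b c d) B@(mat a′ b′ c′ d′) = eval-injective _ _ λ x y → begin
    eval ((P ∣ A) ∣ B) x y
  ≡⟨ eval-∣ (P ∣ A) a′ b′ c′ d′ x y ⟩
    eval (P ∣ A) (L₁ x y) (L₂ x y)
  ≡⟨ eval-∣ P a b c d (L₁ x y) (L₂ x y) ⟩
    eval P (toℚ a * L₁ x y + toℚ b * L₂ x y) (toℚ c * L₁ x y + toℚ d * L₂ x y)
  ≡⟨ cong₂ (eval P) (row a b x y) (row c d x y) ⟨
    eval P (toℚ (a ℤ.* a′ ℤ.+ b ℤ.* c′) * x + toℚ (a ℤ.* b′ ℤ.+ b ℤ.* d′) * y)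
           (toℚ (c ℤ.* a′ ℤ.+ d ℤ.* c′) * x + toℚ (c ℤ.* b′ ℤ.+ d ℤ.* d′) * y)
  ≡⟨ eval-∣ P (a ℤ.* a′ ℤ.+ b ℤ.* c′) (a ℤ.* b′ ℤ.+ b ℤ.* d′) (c ℤ.* a′ ℤ.+ d ℤ.* c′) (c ℤ.* b′ ℤ.+ d ℤ.* d′) x y ⟨
    eval (P ∣ (A ⊗ B)) x y
  ∎
  where
  open ≡-Reasoning
  L₁ L₂ : ℚ → ℚ → ℚ
  L₁ x y = toℚ a′ * x + toℚ b′ * y
  L₂ x y = toℚ c′ * x + toℚ d′ * y
  entry : ∀ p q r s → toℚ (p ℤ.* q ℤ.+ r ℤ.* s) ≡ toℚ p * toℚ q + toℚ r * toℚ s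
  entry p q r s = trans (toℚ-+ (p ℤ.* q) (r ℤ.* s)) (cong₂ _+_ (toℚ-* p q) (toℚ-* r s))
  substitute : ∀ p q a′ b′ c′ d′ x y →
    (p * a′ + q * c′) * x + (p * b′ + q * d′) * y ≡ p * (a′ * x + b′ * y) + q * (c′ * x + d′ * y)
  substitute = solve-∀ ℚ-ring
  row : ∀ p q x y → toℚ (p ℤ.* a′ ℤ.+ q ℤ.* c′) * x + toℚ (p ℤ.* b′ ℤ.+ q ℤ.* d′) * y ≡ toℚ p * L₁ x y + toℚ q * L₂ x y
  row p q x y = trans (cong₂ (λ u v → u * x + v * y) (entry p a′ q c′) (entry p b′ q d′))
                      (substitute (toℚ p) (toℚ q) (toℚ a′) (toℚ b′) (toℚ c′) (toℚ d′) x y)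

monomial-∣ : ∀ {w} → Mat → Fin (suc w) → Fin (suc w) → ℚ
monomial-∣ {w} (mat a b c d) i k =
  mulC (powC (linF (toℚ a) (toℚ b)) (toℕ i)) (powC (linF (toℚ c) (toℚ d)) (w ℕ.∸ toℕ i)) (toℕ k)

⊞-∣ : ∀ {w} (P Q : V w) M → ((P ⊞ Q) ∣ M) ≈ ((P ∣ M) ⊞ (Q ∣ M))
⊞-∣ P Q M@(mat _ _ _ _) k =
  trans (sumFin-cong (λ i → *-distribʳ-+ (monomial-∣ M i k) (P i) (Q i)))
        (sumFin-+ (λ i → P i * monomial-∣ M i k) (λ i → Q i * monomial-∣ M i k))

⊡-∣ : ∀ {w} q (P : V w) M → ((q ⊡ P) ∣ M) ≈ (q ⊡ (P ∣ M))
⊡-∣ q P M@(mat _ _ _ _) k =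
  trans (sumFin-cong (λ i → *-assoc q (P i) (monomial-∣ M i k))) (sym (*-distribˡ-sumFin q (λ i → P i * monomial-∣ M i k)))

∣-cong : ∀ {w} {P Q : V w} M → P ≈ Q → (P ∣ M) ≈ (Q ∣ M)
∣-cong M@(mat _ _ _ _) P≈Q k = sumFin-cong (λ i → cong (_* monomial-∣ M i k) (P≈Q i))

zero-∣ : ∀ {w} {P : V w} M → P ≈ zeroV → (P ∣ M) ≈ zeroV
zero-∣ M@(mat _ _ _ _) P≈0 k = sumFin-zero (λ i → trans (cong (_* monomial-∣ M i k) (P≈0 i)) (*-zeroˡ (monomial-∣ M i k)))

∣-identity : ∀ {w} (P : V w) → (P ∣ I₂) ≈ P
∣-identity P = eval-injective _ _ λ x y → trans (eval-∣ P 1ℤ 0ℤ 0ℤ 1ℤ x y) (cong₂ (eval P) (first x y) (second x y))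
  where
  first : ∀ x y → 1ℚ * x + 0ℚ * y ≡ x
  first = solve-∀ ℚ-ring
  second : ∀ x y → 0ℚ * x + 1ℚ * y ≡ y
  second = solve-∀ ℚ-ring

-I₂ : Mat
-I₂ = mat -1ℤ 0ℤ 0ℤ -1ℤ

eval-neg : ∀ {w} (P : V w) x y → eval P (- x) (- y) ≡ (- 1ℚ) ^ w * eval P x y
eval-neg {zero}  P x y = sym (*-identityˡ (P fzero))
eval-neg {suc w} P x y =
  trans (cong₂ (λ u e → P fzero * u + (- x) * e) (trans (cong (_^ suc w) -y≡-1*y) (^-distrib-* (- 1ℚ) y (suc w)))
                                                 (eval-neg (λ i → P (fsuc i)) x y))
        (regroup (P fzero) ((- 1ℚ) ^ w) y (y ^ w) x (eval (λ i → P (fsuc i)) x y))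
  where
  -y≡-1*y : - y ≡ (- 1ℚ) * y
  -y≡-1*y = trans (cong -_ (sym (*-identityˡ y))) (neg-distribˡ-* 1ℚ y)
  regroup : ∀ p s y Y x e → p * (((- 1ℚ) * s) * (y * Y)) + (- x) * (s * e) ≡ ((- 1ℚ) * s) * (p * (y * Y) + x * e)
  regroup = solve-∀ ℚ-ring

∣-I : ∀ {w} (P : V w) → (P ∣ -I₂) ≈ (((- 1ℚ) ^ w) ⊡ P)
∣-I {w} P = eval-injective _ _ λ x y → trans (eval-∣ P -1ℤ 0ℤ 0ℤ -1ℤ x y)
  (trans (cong₂ (eval P) (first x y) (second x y)) (trans (eval-neg P x y) (sym (eval-⊡ ((- 1ℚ) ^ w) P x y))))
  where
  first : ∀ x y → (- 1ℚ) * x + 0ℚ * y ≡ - x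
  first = solve-∀ ℚ-ring
  second : ∀ x y → 0ℚ * x + (- 1ℚ) * y ≡ - y
  second = solve-∀ ℚ-ring

-1^2n≡1 : ∀ n → (- 1ℚ) ^ (2 ℕ.* n) ≡ 1ℚ
-1^2n≡1 zero    = refl
-1^2n≡1 (suc n) = trans (cong ((- 1ℚ) ^_) (cong suc (ℕ.+-suc n (n ℕ.+ 0))))
                        (cong (λ z → (- 1ℚ) * ((- 1ℚ) * z)) (-1^2n≡1 n))

-1^[1+2n]≡-1 : ∀ n → (- 1ℚ) ^ suc (2 ℕ.* n) ≡ - 1ℚ
-1^[1+2n]≡-1 n = cong ((- 1ℚ) *_) (-1^2n≡1 n)

∣ᴳ-∣ : ∀ {w} (P : V w) x B → ((P ∣ᴳ x) ∣ B) ≈ (P ∣ᴳ map (map₂ (_⊗ B)) x)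
∣ᴳ-∣ P []            B k = zero-∣ B (λ _ → refl) k
∣ᴳ-∣ P ((q , g) ∷ x) B k = trans (⊞-∣ (q ⊡ (P ∣ g)) (P ∣ᴳ x) B k)
  (cong₂ _+_ (trans (⊡-∣ q (P ∣ g) B k) (cong (q *_) (∣-∣ P g B k))) (∣ᴳ-∣ P x B k))

-- The relations as identities of coefficient functions

coeffAt : ∀ {w} → V w → Fin (suc w) → Mat → ℚ
coeffAt P k g = (P ∣ g) k

coeffAt-I₂ : ∀ {w} (P : V w) k → coeffAt P k I₂ ≡ P k
coeffAt-I₂ P k = ∣-identity P k

φ : (Mat → ℚ) → Mat → ℚ
φ q M = q ((γ′ ⊗ δ) ⊗ M) - q ((γ′ ⊗ (ε′ ⊗ δ)) ⊗ M)

ψ : (Mat → ℚ) → Mat → ℚ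
ψ p M = - (ℤ.+ 1 / 3) * (p ((γ ⊗ δ) ⊗ M) + p ((γ ⊗ (ε ⊗ δ)) ⊗ M))

φ-cong : ∀ {q q′ : Mat → ℚ} → (∀ g → q g ≡ q′ g) → ∀ M → φ q M ≡ φ q′ M
φ-cong q≗q′ M = cong₂ _-_ (q≗q′ _) (q≗q′ _)

ψ-cong : ∀ {p p′ : Mat → ℚ} → (∀ g → p g ≡ p′ g) → ∀ M → ψ p M ≡ ψ p′ M
ψ-cong p≗p′ M = cong (- (ℤ.+ 1 / 3) *_) (cong₂ _+_ (p≗p′ _) (p≗p′ _))

Φ-∣ : ∀ {w} (Q : V w) M k → coeffAt (Φ Q) k M ≡ φ (coeffAt Q k) M
Φ-∣ Q M k = begin
    coeffAt (Φ Q) k M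
  ≡⟨ ∣ᴳ-∣ Q ([ γ′ ] ⊛ (([ I₂ ] ⊕ ((- 1ℚ) · [ ε′ ])) ⊛ [ δ ])) M k ⟩
    1ℚ * a + ((- 1ℚ) * b + 0ℚ)
  ≡⟨ difference a b ⟩
    φ (coeffAt Q k) M
  ∎
  where
  open ≡-Reasoning
  a = coeffAt Q k ((γ′ ⊗ δ) ⊗ M)
  b = coeffAt Q k ((γ′ ⊗ (ε′ ⊗ δ)) ⊗ M)
  difference : ∀ a b → 1ℚ * a + ((- 1ℚ) * b + 0ℚ) ≡ a - b
  difference = solve-∀ ℚ-ring

Ψ-∣ : ∀ {w} (P : V w) M k → coeffAt (Ψ P) k M ≡ ψ (coeffAt P k) M
Ψ-∣ P M k = begin
    coeffAt (Ψ P) k M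
  ≡⟨ ⊡-∣ (- (ℤ.+ 1 / 3)) (P ∣ᴳ ψ-element) M k ⟩
    - (ℤ.+ 1 / 3) * coeffAt (P ∣ᴳ ψ-element) k M
  ≡⟨ cong (- (ℤ.+ 1 / 3) *_) (trans (∣ᴳ-∣ P ψ-element M k) (sum a b)) ⟩
    ψ (coeffAt P k) M
  ∎
  where
  open ≡-Reasoning
  ψ-element = [ γ ] ⊛ (([ I₂ ] ⊕ [ ε ]) ⊛ [ δ ])
  a = coeffAt P k ((γ ⊗ δ) ⊗ M)
  b = coeffAt P k ((γ ⊗ (ε ⊗ δ)) ⊗ M)
  sum : ∀ a b → 1ℚ * a + (1ℚ * b + 0ℚ) ≡ a + b
  sum = solve-∀ ℚ-ring

Ψ-value : ∀ {w} (P : V w) k → Ψ P k ≡ ψ (coeffAt P k) I₂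
Ψ-value P k = trans (sym (coeffAt-I₂ (Ψ P) k)) (Ψ-∣ P I₂ k)

record IsFayShuffle (q : Mat → ℚ) : Set where
  field
    antisymmetric : ∀ g → q (ε ⊗ g) ≡ - q g
    three-term    : ∀ g → q (ρ₂ ⊗ g) ≡ - (q g + q (ρ₁ ⊗ g))

record IsLinearShuffle (p : Mat → ℚ) : Set where
  field
    shuffle      : ∀ g → p (δ ⊗ g) ≡ - (p (σ₁ ⊗ g) + p (σ₂ ⊗ g))
    ε′-invariant : ∀ g → p g ≡ p (ε′ ⊗ g)

record IsOddPeriod (p : Mat → ℚ) : Set where
  field
    period : ∀ g → p g ≡ p (τ₁ ⊗ g) + p (τ₂ ⊗ g)

OddUnder-I : (Mat → ℚ) → Set
OddUnder-I q = ∀ g → q (g ⊗ -I₂) ≡ - q g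

EvenUnder-I : (Mat → ℚ) → Set
EvenUnder-I q = ∀ g → q (g ⊗ -I₂) ≡ q g

coeffAt-⊗ : ∀ {w} (P : V w) k A g → coeffAt P k (A ⊗ g) ≡ coeffAt (P ∣ A) k g
coeffAt-⊗ P k A g = sym (∣-∣ P A g k)

FShpol⇒IsFayShuffle : ∀ {w} (Q : V w) → FShpol w Q → ∀ k → IsFayShuffle (coeffAt Q k)
FShpol⇒IsFayShuffle Q (antisym , three) k = record
  { antisymmetric = λ g → inverseʳ-unique _ _ (begin
      coeffAt Q k g + coeffAt Q k (ε ⊗ g)
        ≡⟨ cong (coeffAt Q k g +_) (coeffAt-⊗ Q k ε g) ⟩
      coeffAt Q k g + coeffAt (Q ∣ ε) k g
        ≡⟨ ⊞-∣ Q (Q ∣ ε) g k ⟨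
      coeffAt (Q ⊞ (Q ∣ ε)) k g
        ≡⟨ zero-∣ g antisym k ⟩
      0ℚ ∎)
  ; three-term = λ g → inverseʳ-unique _ _ (begin
      coeffAt Q k g + coeffAt Q k (ρ₁ ⊗ g) + coeffAt Q k (ρ₂ ⊗ g)
        ≡⟨ cong₂ (λ a b → coeffAt Q k g + a + b) (coeffAt-⊗ Q k ρ₁ g) (coeffAt-⊗ Q k ρ₂ g) ⟩
      coeffAt Q k g + coeffAt (Q ∣ ρ₁) k g + coeffAt (Q ∣ ρ₂) k g
        ≡⟨ cong (_+ coeffAt (Q ∣ ρ₂) k g) (⊞-∣ Q (Q ∣ ρ₁) g k) ⟨
      coeffAt (Q ⊞ (Q ∣ ρ₁)) k g + coeffAt (Q ∣ ρ₂) k g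
        ≡⟨ ⊞-∣ (Q ⊞ (Q ∣ ρ₁)) (Q ∣ ρ₂) g k ⟨
      coeffAt ((Q ⊞ (Q ∣ ρ₁)) ⊞ (Q ∣ ρ₂)) k g
        ≡⟨ zero-∣ g three k ⟩
      0ℚ ∎)
  }
  where open ≡-Reasoning

LSh2⇒IsLinearShuffle : ∀ {w} (P : V w) → LSh2 w P → ∀ k → IsLinearShuffle (coeffAt P k)
LSh2⇒IsLinearShuffle P (shuffle , invariant) k = record
  { shuffle = λ g → solve-for-c (coeffAt P k (σ₁ ⊗ g) + coeffAt P k (σ₂ ⊗ g)) (coeffAt P k (δ ⊗ g)) (begin
      coeffAt P k (σ₁ ⊗ g) + coeffAt P k (σ₂ ⊗ g)
        ≡⟨ cong₂ _+_ (coeffAt-⊗ P k σ₁ g) (coeffAt-⊗ P k σ₂ g) ⟩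
      coeffAt (P ∣ σ₁) k g + coeffAt (P ∣ σ₂) k g
        ≡⟨ ⊞-∣ (P ∣ σ₁) (P ∣ σ₂) g k ⟨
      coeffAt ((P ∣ σ₁) ⊞ (P ∣ σ₂)) k g
        ≡⟨ ∣-cong g shuffle k ⟩
      coeffAt ((- 1ℚ) ⊡ (P ∣ δ)) k g
        ≡⟨ ⊡-∣ (- 1ℚ) (P ∣ δ) g k ⟩
      (- 1ℚ) * coeffAt (P ∣ δ) k g
        ≡⟨ cong ((- 1ℚ) *_) (coeffAt-⊗ P k δ g) ⟨
      (- 1ℚ) * coeffAt P k (δ ⊗ g) ∎)
  ; ε′-invariant = λ g → trans (∣-cong g invariant k) (∣-∣ P ε′ g k)
  }
  where
  open ≡-Reasoning
  solve-for-c : ∀ a c → a ≡ (- 1ℚ) * c → c ≡ - a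
  solve-for-c _ c refl = negate c
    where
    negate : ∀ c → c ≡ - ((- 1ℚ) * c)
    negate = solve-∀ ℚ-ring

Wod⇒IsOddPeriod : ∀ {w} (P : V w) → Wod w P → ∀ k → IsOddPeriod (coeffAt P k)
Wod⇒IsOddPeriod P period k = record
  { period = λ g → solve-for-a (coeffAt P k g) (coeffAt P k (τ₁ ⊗ g)) (coeffAt P k (τ₂ ⊗ g)) (begin
      coeffAt P k g + (- 1ℚ) * coeffAt P k (τ₁ ⊗ g) + (- 1ℚ) * coeffAt P k (τ₂ ⊗ g)
        ≡⟨ cong₂ (λ a b → coeffAt P k g + (- 1ℚ) * a + (- 1ℚ) * b) (coeffAt-⊗ P k τ₁ g) (coeffAt-⊗ P k τ₂ g) ⟩
      coeffAt P k g + (- 1ℚ) * coeffAt (P ∣ τ₁) k g + (- 1ℚ) * coeffAt (P ∣ τ₂) k g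
        ≡⟨ cong₂ (λ a b → coeffAt P k g + a + b) (⊡-∣ (- 1ℚ) (P ∣ τ₁) g k) (⊡-∣ (- 1ℚ) (P ∣ τ₂) g k) ⟨
      coeffAt P k g + coeffAt ((- 1ℚ) ⊡ (P ∣ τ₁)) k g + coeffAt ((- 1ℚ) ⊡ (P ∣ τ₂)) k g
        ≡⟨ cong (_+ coeffAt ((- 1ℚ) ⊡ (P ∣ τ₂)) k g) (⊞-∣ P ((- 1ℚ) ⊡ (P ∣ τ₁)) g k) ⟨
      coeffAt (P ⊞ ((- 1ℚ) ⊡ (P ∣ τ₁))) k g + coeffAt ((- 1ℚ) ⊡ (P ∣ τ₂)) k g
        ≡⟨ ⊞-∣ (P ⊞ ((- 1ℚ) ⊡ (P ∣ τ₁))) ((- 1ℚ) ⊡ (P ∣ τ₂)) g k ⟨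
      coeffAt ((P ⊞ ((- 1ℚ) ⊡ (P ∣ τ₁))) ⊞ ((- 1ℚ) ⊡ (P ∣ τ₂))) k g
        ≡⟨ zero-∣ g period k ⟩
      0ℚ ∎)
  }
  where
  open ≡-Reasoning
  solve-for-a : ∀ a b c → a + (- 1ℚ) * b + (- 1ℚ) * c ≡ 0ℚ → a ≡ b + c
  solve-for-a a b c eq = trans (isolate a b c) (trans (cong (_+ (b + c)) eq) (+-identityˡ (b + c)))
    where
    isolate : ∀ a b c → a ≡ (a + (- 1ℚ) * b + (- 1ℚ) * c) + (b + c)
    isolate = solve-∀ ℚ-ring

coeffAt-⊗-I : ∀ {w} (P : V w) k g → coeffAt P k (g ⊗ -I₂) ≡ (- 1ℚ) ^ w * coeffAt P k g
coeffAt-⊗-I P k g = trans (sym (∣-∣ P g -I₂ k)) (∣-I (P ∣ g) k)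

odd⇒OddUnder-I : ∀ n (P : V (suc (2 ℕ.* n))) k → OddUnder-I (coeffAt P k)
odd⇒OddUnder-I n P k g = trans (coeffAt-⊗-I P k g)
  (trans (cong (_* coeffAt P k g) (-1^[1+2n]≡-1 n)) (-1*x≈-x (coeffAt P k g)))

even⇒EvenUnder-I : ∀ n (P : V (2 ℕ.* n)) k → EvenUnder-I (coeffAt P k)
even⇒EvenUnder-I n P k g = trans (coeffAt-⊗-I P k g)
  (trans (cong (_* coeffAt P k g) (-1^2n≡1 n)) (*-identityˡ (coeffAt P k g)))

-- Each proof uses a few instances of the relations as rewrite rules, each eliminating one value of the
-- coefficient function, in an order in which no eliminated value is reintroduced; the ring solver
-- closes what remains.
c≡-[a+b]⇒a≡-[b+c] : ∀ a b c → c ≡ - (a + b) → a ≡ - (b + c)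
c≡-[a+b]⇒a≡-[b+c] a b _ refl = solve (a ∷ b ∷ []) ℚ-ring

c≡-[a+b]⇒b≡-[a+c] : ∀ a b c → c ≡ - (a + b) → b ≡ - (a + c)
c≡-[a+b]⇒b≡-[a+c] a b _ refl = solve (a ∷ b ∷ []) ℚ-ring

module FayShuffle {q : Mat → ℚ} (F : IsFayShuffle q) where
  open IsFayShuffle F public

  three-term₀ : ∀ g → q g ≡ - (q (ρ₁ ⊗ g) + q (ρ₂ ⊗ g))
  three-term₀ g = c≡-[a+b]⇒a≡-[b+c] (q g) (q (ρ₁ ⊗ g)) (q (ρ₂ ⊗ g)) (three-term g)

  three-term₁ : ∀ g → q (ρ₁ ⊗ g) ≡ - (q g + q (ρ₂ ⊗ g))
  three-term₁ g = c≡-[a+b]⇒b≡-[a+c] (q g) (q (ρ₁ ⊗ g)) (q (ρ₂ ⊗ g)) (three-term g)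

module _ {q : Mat → ℚ} (F : IsFayShuffle q) (odd : OddUnder-I q) where
  open FayShuffle F

  ψ∘φ≡id : ψ (φ q) I₂ ≡ q I₂
  ψ∘φ≡id rewrite odd ε | three-term₁ I₂ | antisymmetric ε with q ρ₂ | q ε
  ... | a | b = solve (a ∷ b ∷ []) ℚ-ring

  φ-shuffle : φ q σ₁ + φ q σ₂ ≡ - φ q δ
  φ-shuffle
    rewrite odd ε | odd I₂ | three-term₁ γ′ | antisymmetric (mat -1ℤ -1ℤ 0ℤ 1ℤ) | three-term ε
          | three-term₀ (mat 1ℤ 1ℤ -1ℤ 0ℤ) | antisymmetric I₂ | three-term₀ I₂ | antisymmetric (mat 0ℤ -1ℤ 1ℤ 1ℤ)
    with q ρ₂ | q (mat 0ℤ -1ℤ 1ℤ 1ℤ)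
  ... | a | b = solve (a ∷ b ∷ []) ℚ-ring

  φ-ε′-invariant : φ q I₂ ≡ φ q ε′
  φ-ε′-invariant
    rewrite odd (mat 0ℤ 1ℤ 1ℤ -1ℤ) | three-term (mat 1ℤ -1ℤ 0ℤ 1ℤ) | three-term₀ δ | three-term₁ (mat 0ℤ 1ℤ -1ℤ 0ℤ)
          | antisymmetric (mat -1ℤ 0ℤ 0ℤ 1ℤ) | three-term₁ (mat 0ℤ 1ℤ 1ℤ -1ℤ) | antisymmetric (mat 1ℤ -1ℤ 0ℤ 1ℤ)
    with q (mat -1ℤ 0ℤ 0ℤ 1ℤ) | q (mat 1ℤ -1ℤ 0ℤ 1ℤ)
  ... | a | b = solve (a ∷ b ∷ []) ℚ-ring

ψ-antisymmetric : ∀ {p} → OddUnder-I p → ψ p I₂ + ψ p ε ≡ 0ℚ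
ψ-antisymmetric {p} odd rewrite odd σ₂ | odd σ₁ with p σ₂ | p σ₁
... | a | b = solve (a ∷ b ∷ []) ℚ-ring

module _ {p : Mat → ℚ} (L : IsLinearShuffle p) where
  open IsLinearShuffle L

  ψ-three-term : ψ p I₂ + ψ p ρ₁ + ψ p ρ₂ ≡ 0ℚ
  ψ-three-term
    rewrite sym (ε′-invariant τ₂) | shuffle ρ₁ | sym (ε′-invariant (mat 0ℤ 1ℤ -1ℤ 0ℤ)) | shuffle γ′
    with p (mat -1ℤ -1ℤ -1ℤ 0ℤ) | p (mat 0ℤ -1ℤ 1ℤ 0ℤ) | p (mat 0ℤ 1ℤ -1ℤ 0ℤ) | p τ₂
  ... | a | b | c | d = solve (a ∷ b ∷ c ∷ d ∷ []) ℚ-ring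

  φ∘ψ≡id : OddUnder-I p → φ (ψ p) I₂ ≡ p I₂
  φ∘ψ≡id odd
    rewrite odd (mat 1ℤ -1ℤ 1ℤ 0ℤ) | sym (ε′-invariant (mat 0ℤ 1ℤ -1ℤ 1ℤ)) | shuffle (mat 0ℤ 1ℤ 1ℤ -1ℤ)
          | odd ε′ | sym (ε′-invariant I₂)
    with p (mat 1ℤ -1ℤ 1ℤ 0ℤ) | p I₂
  ... | a | b = solve (a ∷ b ∷ []) ℚ-ring

module _ {p : Mat → ℚ} (W : IsOddPeriod p) where
  open IsOddPeriod W

  period-δ-τ₁ : p τ₁ + p (δ ⊗ τ₁) ≡ p I₂ + p δ
  period-δ-τ₁
    rewrite period ρ₁ | period σ₁ | period I₂ | period τ₂
    with p δ | p τ₁ | p (mat (ℤ.+ 2) 1ℤ 1ℤ 0ℤ) | p (mat (ℤ.+ 2) 1ℤ 1ℤ 1ℤ)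
  ... | a | b | c | d = solve (a ∷ b ∷ c ∷ d ∷ []) ℚ-ring

  period-δ-σ₁ : EvenUnder-I p → p σ₁ + p (δ ⊗ σ₁) ≡ p I₂ + p δ
  period-δ-σ₁ even
    rewrite period σ₁ | period δ | period (mat 1ℤ 0ℤ -1ℤ -1ℤ) | even (mat 0ℤ 1ℤ -1ℤ 0ℤ) | period (mat 0ℤ 1ℤ -1ℤ 0ℤ)
          | even (mat 1ℤ -1ℤ 0ℤ -1ℤ) | even (mat 1ℤ -1ℤ 1ℤ 0ℤ) | even σ₂ | period σ₂ | period I₂ | period τ₂ | period τ₁
    with p (mat 1ℤ -1ℤ 0ℤ -1ℤ) | p (mat 1ℤ -1ℤ 1ℤ 0ℤ) | p (mat 1ℤ (ℤ.+ 2) 0ℤ 1ℤ)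
       | p (mat 1ℤ (ℤ.+ 2) 1ℤ 1ℤ) | p (mat (ℤ.+ 2) 1ℤ 1ℤ 0ℤ) | p (mat (ℤ.+ 2) 1ℤ 1ℤ 1ℤ)
  ... | a | b | c | d | e | f = solve (a ∷ b ∷ c ∷ d ∷ e ∷ f ∷ []) ℚ-ring

  period-shuffle : p δ ≡ - p I₂ → p σ₁ + p σ₂ ≡ - p δ
  period-shuffle δ-anti
    rewrite δ-anti | period I₂ | period τ₂ | period τ₁ | period σ₁ | period σ₂
    with p (mat 1ℤ (ℤ.+ 2) 0ℤ 1ℤ) | p (mat 1ℤ (ℤ.+ 2) 1ℤ 1ℤ) | p (mat (ℤ.+ 2) 1ℤ 1ℤ 0ℤ) | p (mat (ℤ.+ 2) 1ℤ 1ℤ 1ℤ)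
  ... | a | b | c | d = solve (a ∷ b ∷ c ∷ d ∷ []) ℚ-ring

  period-ε′-invariant : EvenUnder-I p → p I₂ ≡ p ε′
  period-ε′-invariant even rewrite even ε | period ε | period I₂ with p τ₁ | p τ₂
  ... | a | b = solve (a ∷ b ∷ []) ℚ-ring

-- Odd period polynomials of even weight

-- τ₁-invariance makes t ↦ u(t, 1) constant on ℕ, so u - u₀ Y^(w+1) vanishes on ℕ⁺ and u = u₀ Y^(w+1);
-- σ₁-invariance then gives u₀ = u(1, 1) = u(1, 0) = 0.
translation-invariant⇒zero : ∀ {w} (u : V (suc w)) → (u ∣ τ₁) ≈ u → (u ∣ σ₁) ≈ u → u ≈ zeroV
translation-invariant⇒zero {w} u τ₁-inv σ₁-inv = λ { fzero → head≡0 ; (fsuc i) → tail≡0 i }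
  where
  open ≡-Reasoning
  tail = λ i → u (fsuc i)
  shiftˣ : ∀ x y → eval u (x + y) y ≡ eval u x y
  shiftˣ x y = trans (cong₂ (eval u) (first x y) (second x y)) (trans (sym (eval-∣ u 1ℤ 1ℤ 0ℤ 1ℤ x y)) (eval-cong x y τ₁-inv))
    where
    first : ∀ x y → x + y ≡ 1ℚ * x + 1ℚ * y
    first = solve-∀ ℚ-ring
    second : ∀ x y → y ≡ 0ℚ * x + 1ℚ * y
    second = solve-∀ ℚ-ring
  shiftʸ : ∀ x y → eval u x (x + y) ≡ eval u x y
  shiftʸ x y = trans (cong₂ (eval u) (first x y) (second x y)) (trans (sym (eval-∣ u 1ℤ 0ℤ 1ℤ 1ℤ x y)) (eval-cong x y σ₁-inv))
    where
    first : ∀ x y → x ≡ 1ℚ * x + 0ℚ * y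
    first = solve-∀ ℚ-ring
    second : ∀ x y → x + y ≡ 1ℚ * x + 1ℚ * y
    second = solve-∀ ℚ-ring
  constant-on-ℕ : ∀ n → eval u (fromℕ n) 1ℚ ≡ eval u 0ℚ 1ℚ
  constant-on-ℕ zero    = refl
  constant-on-ℕ (suc n) = trans (cong (λ t → eval u t 1ℚ) (+-comm 1ℚ (fromℕ n)))
                                (trans (shiftˣ (fromℕ n) 1ℚ) (constant-on-ℕ n))
  u-u₀ : V (suc w)
  u-u₀ fzero    = 0ℚ
  u-u₀ (fsuc i) = u (fsuc i)
  u-u₀-vanishes : VanishesOnℕ⁺ u-u₀
  u-u₀-vanishes n =
    trans (drop-constant (u fzero) (1ℚ ^ suc w) (fromℕ (suc n)) (eval tail (fromℕ (suc n)) 1ℚ) (eval tail 0ℚ 1ℚ))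
          (trans (cong (_+ - eval u 0ℚ 1ℚ) (constant-on-ℕ (suc n))) (+-inverseʳ (eval u 0ℚ 1ℚ)))
    where
    drop-constant : ∀ u₀ c t e e₀ → 0ℚ * c + t * e ≡ (u₀ * c + t * e) + - (u₀ * c + 0ℚ * e₀)
    drop-constant = solve-∀ ℚ-ring
  tail≡0 : ∀ i → u (fsuc i) ≡ 0ℚ
  tail≡0 i = vanishesOnℕ⁺⇒zero u-u₀ u-u₀-vanishes (fsuc i)
  eval-tail : ∀ x y → eval tail x y ≡ 0ℚ
  eval-tail x y = eval-zero x y tail≡0
  head≡0 : u fzero ≡ 0ℚ
  head≡0 = begin
      u fzero
    ≡⟨ at-one (u fzero) ⟨
      u fzero * 1ℚ + 1ℚ * 0ℚ
    ≡⟨ cong₂ (λ a b → u fzero * a + 1ℚ * b) (sym (1^n≡1 (suc w))) (sym (eval-tail 1ℚ (1ℚ + 0ℚ))) ⟩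
      eval u 1ℚ (1ℚ + 0ℚ)
    ≡⟨ shiftʸ 1ℚ 0ℚ ⟩
      u fzero * (0ℚ * 0ℚ ^ w) + 1ℚ * eval tail 1ℚ 0ℚ
    ≡⟨ cong (λ b → u fzero * (0ℚ * 0ℚ ^ w) + 1ℚ * b) (eval-tail 1ℚ 0ℚ) ⟩
      u fzero * (0ℚ * 0ℚ ^ w) + 1ℚ * 0ℚ
    ≡⟨ at-zero (u fzero) (0ℚ ^ w) ⟩
      0ℚ
    ∎
    where
    at-one : ∀ a → a * 1ℚ + 1ℚ * 0ℚ ≡ a
    at-one = solve-∀ ℚ-ring
    at-zero : ∀ a c → a * (0ℚ * c) + 1ℚ * 0ℚ ≡ 0ℚ
    at-zero = solve-∀ ℚ-ring

degree0-∣ : ∀ (P : V 0) M → coeffAt P fzero M ≡ P fzero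
degree0-∣ P (mat a b c d) = eval-∣ P a b c d 0ℚ 0ℚ

coeffAt-⊞-∣δ : ∀ {w} (P : V w) k g → coeffAt (P ⊞ (P ∣ δ)) k g ≡ coeffAt P k g + coeffAt P k (δ ⊗ g)
coeffAt-⊞-∣δ P k g = trans (⊞-∣ P (P ∣ δ) g k) (cong (coeffAt P k g +_) (∣-∣ P δ g k))

Wod⇒δ-antiinvariant : ∀ n (P : V (2 ℕ.* n)) → Wod _ P → (P ⊞ (P ∣ δ)) ≈ zeroV
Wod⇒δ-antiinvariant zero    P W fzero =
  trans (cong₂ _+_ P₀≡0 (trans (degree0-∣ P δ) P₀≡0)) (+-identityʳ 0ℚ)
  where
  open IsOddPeriod (Wod⇒IsOddPeriod P W fzero)
  -- In weight 0 the period relation reads P = P + P.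
  P₀≡0 : P fzero ≡ 0ℚ
  P₀≡0 = identityʳ-unique (P fzero) (P fzero) (sym (begin
      P fzero                                          ≡⟨ degree0-∣ P I₂ ⟨
      coeffAt P fzero I₂                               ≡⟨ period I₂ ⟩
      coeffAt P fzero τ₁ + coeffAt P fzero τ₂          ≡⟨ cong₂ _+_ (degree0-∣ P τ₁) (degree0-∣ P τ₂) ⟩
      P fzero + P fzero                                ∎))
    where open ≡-Reasoning
Wod⇒δ-antiinvariant (suc m) P W =
  translation-invariant⇒zero u (λ k → invariant τ₁ k (period-δ-τ₁ (W′ k)))
                               (λ k → invariant σ₁ k (period-δ-σ₁ (W′ k) (even⇒EvenUnder-I (suc m) P k)))
  where
  u = P ⊞ (P ∣ δ)
  W′ = Wod⇒IsOddPeriod P W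
  invariant : ∀ g k → coeffAt P k g + coeffAt P k (δ ⊗ g) ≡ coeffAt P k I₂ + coeffAt P k δ → (u ∣ g) k ≡ u k
  invariant g k eq = trans (coeffAt-⊞-∣δ P k g) (trans eq (cong (_+ coeffAt P k δ) (coeffAt-I₂ P k)))

Wod⇒LSh2 : ∀ w → Even w → (P : V w) → Wod w P → LSh2 w P
Wod⇒LSh2 w (n , refl) P W = shuffle , invariant
  where
  W′ = Wod⇒IsOddPeriod P W
  shuffle : ((P ∣ σ₁) ⊞ (P ∣ σ₂)) ≈ ((- 1ℚ) ⊡ (P ∣ δ))
  shuffle k = trans (period-shuffle (W′ k) δ-anti) (sym (-1*x≈-x (coeffAt P k δ)))
    where
    δ-anti : coeffAt P k δ ≡ - coeffAt P k I₂
    δ-anti = inverseʳ-unique (coeffAt P k I₂) (coeffAt P k δ)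
      (trans (cong (_+ coeffAt P k δ) (coeffAt-I₂ P k)) (Wod⇒δ-antiinvariant n P W k))
  invariant : P ≈ (P ∣ ε′)
  invariant k = trans (sym (coeffAt-I₂ P k)) (period-ε′-invariant (W′ k) (even⇒EvenUnder-I n P k))

-- The maps Φ and Ψ in odd weight

module _ (n : ℕ) where
  private
    w = suc (2 ℕ.* n)

  Φ-FShpol⇒LSh2 : (Q : V w) → FShpol w Q → LSh2 w (Φ Q)
  Φ-FShpol⇒LSh2 Q F = shuffle , invariant
    where
    F′ = FShpol⇒IsFayShuffle Q F
    odd = odd⇒OddUnder-I n Q
    shuffle : ((Φ Q ∣ σ₁) ⊞ (Φ Q ∣ σ₂)) ≈ ((- 1ℚ) ⊡ (Φ Q ∣ δ))
    shuffle k = begin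
      coeffAt (Φ Q) k σ₁ + coeffAt (Φ Q) k σ₂         ≡⟨ cong₂ _+_ (Φ-∣ Q σ₁ k) (Φ-∣ Q σ₂ k) ⟩
      φ (coeffAt Q k) σ₁ + φ (coeffAt Q k) σ₂        ≡⟨ φ-shuffle (F′ k) (odd k) ⟩
      - φ (coeffAt Q k) δ                            ≡⟨ -1*x≈-x _ ⟨
      (- 1ℚ) * φ (coeffAt Q k) δ                     ≡⟨ cong ((- 1ℚ) *_) (Φ-∣ Q δ k) ⟨
      (- 1ℚ) * coeffAt (Φ Q) k δ                     ∎
      where open ≡-Reasoning
    invariant : Φ Q ≈ (Φ Q ∣ ε′)
    invariant k = begin
      Φ Q k                    ≡⟨ coeffAt-I₂ (Φ Q) k ⟨
      coeffAt (Φ Q) k I₂       ≡⟨ Φ-∣ Q I₂ k ⟩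
      φ (coeffAt Q k) I₂       ≡⟨ φ-ε′-invariant (F′ k) (odd k) ⟩
      φ (coeffAt Q k) ε′       ≡⟨ Φ-∣ Q ε′ k ⟨
      coeffAt (Φ Q) k ε′       ∎
      where open ≡-Reasoning

  Ψ-LSh2⇒FShpol : (P : V w) → LSh2 w P → FShpol w (Ψ P)
  Ψ-LSh2⇒FShpol P L = antisymmetric , three-term
    where
    antisymmetric : (Ψ P ⊞ (Ψ P ∣ ε)) ≈ zeroV
    antisymmetric k = trans (cong₂ _+_ (Ψ-value P k) (Ψ-∣ P ε k)) (ψ-antisymmetric (odd⇒OddUnder-I n P k))
    three-term : ((Ψ P ⊞ (Ψ P ∣ ρ₁)) ⊞ (Ψ P ∣ ρ₂)) ≈ zeroV
    three-term k = trans (cong₂ _+_ (cong₂ _+_ (Ψ-value P k) (Ψ-∣ P ρ₁ k)) (Ψ-∣ P ρ₂ k))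
                         (ψ-three-term (LSh2⇒IsLinearShuffle P L k))

  Ψ∘Φ≈id : (Q : V w) → FShpol w Q → Ψ (Φ Q) ≈ Q
  Ψ∘Φ≈id Q F k = begin
    Ψ (Φ Q) k                     ≡⟨ Ψ-value (Φ Q) k ⟩
    ψ (coeffAt (Φ Q) k) I₂        ≡⟨ ψ-cong (λ g → Φ-∣ Q g k) I₂ ⟩
    ψ (φ (coeffAt Q k)) I₂        ≡⟨ ψ∘φ≡id (FShpol⇒IsFayShuffle Q F k) (odd⇒OddUnder-I n Q k) ⟩
    coeffAt Q k I₂                ≡⟨ coeffAt-I₂ Q k ⟩
    Q k                           ∎
    where open ≡-Reasoning

  Φ∘Ψ≈id : (P : V w) → LSh2 w P → Φ (Ψ P) ≈ P
  Φ∘Ψ≈id P L k = begin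
    Φ (Ψ P) k                     ≡⟨ coeffAt-I₂ (Φ (Ψ P)) k ⟨
    coeffAt (Φ (Ψ P)) k I₂        ≡⟨ Φ-∣ (Ψ P) I₂ k ⟩
    φ (coeffAt (Ψ P) k) I₂        ≡⟨ φ-cong (λ g → Ψ-∣ P g k) I₂ ⟩
    φ (ψ (coeffAt P k)) I₂        ≡⟨ φ∘ψ≡id (LSh2⇒IsLinearShuffle P L k) (odd⇒OddUnder-I n P k) ⟩
    coeffAt P k I₂                ≡⟨ coeffAt-I₂ P k ⟩
    P k                           ∎
    where open ≡-Reasoning

theorem1p3 : ((w : ℕ) → Even w → (P : V w) → Wod w P → LSh2 w P)
    × ((w : ℕ) → Odd w →
    ((Q : V w) → FShpol w Q → LSh2 w (Φ Q))
    × ((P : V w) → LSh2 w P → FShpol w (Ψ P))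
    × ((Q : V w) → FShpol w Q → Ψ (Φ Q) ≈ Q)
    × ((P : V w) → LSh2 w P → Φ (Ψ P) ≈ P))
theorem1p3 = Wod⇒LSh2 , λ { w (n , refl) → Φ-FShpol⇒LSh2 n , Ψ-LSh2⇒FShpol n , Ψ∘Φ≈id n , Φ∘Ψ≈id n }
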